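{- The reduced suspension preserves derivability: if $\Delta\vdash_{\mathsf{MCaTT}}$ then $\Sigma_r\Delta\vdash_{\mathsf{CaTT}}$; if $\Delta\vdash_{\mathsf{MCaTT}}A$ then $\Sigma_r\Delta\vdash_{\mathsf{CaTT}}\Sigma_rA$; if $\Delta\vdash_{\mathsf{MCaTT}}t:A$ then $\Sigma_r\Delta\vdash_{\mathsf{CaTT}}\Sigma_rt:\Sigma_rA$; and if $\Delta\vdash_{\mathsf{MCaTT}}\gamma:\Gamma$ then $\Sigma_r\Delta\vdash_{\mathsf{CaTT}}\Sigma_r\gamma:\Sigma_r\Gamma$.
   Context: $\mathsf{CaTT}$ is the Finster–Mimram type theory for weak $\omega$-categories (types $\star$, $\mathrm{Hom}_Atu$; terms variables, $\mathsf{op}_{\Theta,A}[\gamma]$, $\mathsf{coh}_{\Theta,A}[\gamma]$ for ps-contexts $\Theta$). $\mathsf{MCaTT}$ is the type theory with a unit type $\mathbb{1}$ (constant $()$ and $\eta$-rule making every term of type $\mathbb{1}$ definitionally equal to $()$, so that normal forms exist), types $\mathrm{Hom}_Atu$ ($\star$ abbreviating $\mathrm{Hom}_{\mathbb{1}}()()$), and term constructors $\mathsf{mop}_{\Theta,A}[\gamma]$, $\mathsf{mcoh}_{\Theta,A}[\gamma]$ with $\gamma$ a substitution into the desuspension $\mathrm{D}\Theta$ (where $\mathrm{D}$ replaces $\star$ by $\mathbb{1}$, $\mathsf{op}$ by $\mathsf{mop}$, $\mathsf{coh}$ by $\mathsf{mcoh}$). The reduced suspension $\Sigma_r$ is defined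 on derivable $\mathsf{MCaTT}$ expressions in normal form, using a fresh variable $\bullet$: $\Sigma_r\emptyset=(\bullet:\star)$, $\Sigma_r(\Gamma,x:\mathbb{1})=\Sigma_r\Gamma$, $\Sigma_r(\Gamma,x:A)=(\Sigma_r\Gamma,x:\Sigma_rA)$ for $A\neq\mathbb{1}$; $\Sigma_r\mathbb{1}=\star$, $\Sigma_r\star=\mathrm{Hom}_\star\bullet\bullet$, $\Sigma_r(\mathrm{Hom}_Atu)=\mathrm{Hom}_{\Sigma_rA}(\Sigma_rt)(\Sigma_ru)$; $\Sigma_r()=\bullet$, $\Sigma_rx=x$ for variables of type $\neq\mathbb{1}$, $\Sigma_r(\mathsf{mop}_{\Theta,A}[\gamma])=\mathsf{op}_{\Theta,A}[\bullet_\Theta\circ\Sigma_r\gamma]$, $\Sigma_r(\mathsf{mcoh}_{\Theta,A}[\gamma])=\mathsf{coh}_{\Theta,A}[\bullet_\Theta\circ\Sigma_r\gamma]$; $\Sigma_r\langle\rangle=\langle\bullet\mapsto\bullet\rangle$, $\Sigma_r\langle\gamma,x\mapsto t\rangle=\Sigma_r\gamma$ if $x$ has type $\mathbb{1}$ and $\langle\Sigma_r\gamma,x\mapsto\Sigma_rt\rangle$ otherwise. Here, for a $\mathsf{CaTT}$ context $\Theta$, $\bullet_\emptyset=\langle\rangle$ and $\bullet_{(\Theta,x:A)}=\langle\bullet_\Theta,x\mapsto\Sigma_r(\mathrm{D}x)\rangle$. -}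

module Defs where

-- The fresh variable • of the
-- reduced suspension is encoded as the CaTT variable 0, and an MCaTT variable
-- x is sent to the CaTT variable suc x (so • is fresh by construction).

open import Data.Nat using (ℕ; zero; suc; _∸_; _⊔_; _≡ᵇ_; _<ᵇ_)
open import Data.Bool using (Bool; true; false; if_then_else_)
open import Data.List using (List; []; _∷_; _++_)
open import Data.List.Membership.Propositional using (_∈_; _∉_)
open import Data.Maybe using (Maybe; just; nothing)
open import Data.Product using (_×_)
open import Relation.Binary.PropositionalEquality using (_≡_)
open import Relation.Nullary using (¬_)

infixl 5 _▸_∶_ _▹_↦_

mutual
  data CTy : Set where
    ⋆   : CTy
    Hom : CTy → CTm → CTm → CTy

  data CTm : Set where
    var : ℕ → CTm
    op  : CCtx → CTy → CSub → CTm
    coh : CCtx → CTy → CSub → CTm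

  data CCtx : Set where
    ∅     : CCtx
    _▸_∶_ : CCtx → ℕ → CTy → CCtx

  data CSub : Set where
    ⟨⟩    : CSub
    _▹_↦_ : CSub → ℕ → CTm → CSub

dom : CCtx → List ℕ
dom ∅ = []
dom (Γ ▸ x ∶ A) = x ∷ dom Γ

lookupC : CCtx → ℕ → Maybe CTy
lookupC ∅ x = nothing
lookupC (Γ ▸ y ∶ A) x = if x ≡ᵇ y then just A else lookupC Γ x

lookupS : CSub → ℕ → CTm
lookupS ⟨⟩ x = var x
lookupS (γ ▹ y ↦ t) x = if x ≡ᵇ y then t else lookupS γ x

mutual
  _[_]T : CTy → CSub → CTy
  ⋆ [ δ ]T = ⋆
  Hom A t u [ δ ]T = Hom (A [ δ ]T) (t [ δ ]t) (u [ δ ]t)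

  _[_]t : CTm → CSub → CTm
  var x [ δ ]t = lookupS δ x
  op Θ A γ [ δ ]t = op Θ A (γ ∘C δ)
  coh Θ A γ [ δ ]t = coh Θ A (γ ∘C δ)

  _∘C_ : CSub → CSub → CSub
  ⟨⟩ ∘C δ = ⟨⟩
  (γ ▹ x ↦ t) ∘C δ = (γ ∘C δ) ▹ x ↦ (t [ δ ]t)

mutual
  VarTy : CTy → List ℕ
  VarTy ⋆ = []
  VarTy (Hom A t u) = VarTy A ++ (VarTm t ++ VarTm u)

  VarTm : CTm → List ℕ
  VarTm (var x) = x ∷ []
  VarTm (op Θ A γ) = VarSub γ
  VarTm (coh Θ A γ) = VarSub γ

  VarSub : CSub → List ℕ
  VarSub ⟨⟩ = []
  VarSub (γ ▹ x ↦ t) = VarSub γ ++ VarTm t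

_≈V_ : List ℕ → List ℕ → Set
xs ≈V ys = (∀ z → z ∈ xs → z ∈ ys) × (∀ z → z ∈ ys → z ∈ xs)

dimTy : CTy → ℕ
dimTy ⋆ = 0
dimTy (Hom A t u) = suc (dimTy A)

dimCtx : CCtx → ℕ
dimCtx ∅ = 0
dimCtx (Γ ▸ x ∶ A) = dimCtx Γ ⊔ dimTy A

drop : CCtx → CCtx
drop ∅ = ∅
drop (Γ ▸ x ∶ A) = Γ

-- i-source and i-target of a ps-context (Finster–Mimram)
∂⁻[_] : ℕ → CCtx → CCtx
∂⁻[ i ] ∅ = ∅
∂⁻[ i ] (∅ ▸ x ∶ A) = ∅ ▸ x ∶ A
∂⁻[ i ] (Γ ▸ y ∶ A ▸ f ∶ B) =
  if i <ᵇ suc (dimTy A) then ∂⁻[ i ] Γ else (∂⁻[ i ] Γ ▸ y ∶ A ▸ f ∶ B)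

∂⁺[_] : ℕ → CCtx → CCtx
∂⁺[ i ] ∅ = ∅
∂⁺[ i ] (∅ ▸ x ∶ A) = ∅ ▸ x ∶ A
∂⁺[ i ] (Γ ▸ y ∶ A ▸ f ∶ B) =
  if i <ᵇ dimTy A then ∂⁺[ i ] Γ
  else (if dimTy A ≡ᵇ i then (drop (∂⁺[ i ] Γ) ▸ y ∶ A)
        else (∂⁺[ i ] Γ ▸ y ∶ A ▸ f ∶ B))

∂⁻ : CCtx → CCtx
∂⁻ Γ = ∂⁻[ dimCtx Γ ∸ 1 ] Γ

∂⁺ : CCtx → CCtx
∂⁺ Γ = ∂⁺[ dimCtx Γ ∸ 1 ] Γ

infix 4 _⊢ps_∶_ _⊢ps

data _⊢ps_∶_ : CCtx → ℕ → CTy → Set where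
  pss : ∀ x → (∅ ▸ x ∶ ⋆) ⊢ps x ∶ ⋆
  pse : ∀ {Γ x A y f} → Γ ⊢ps x ∶ A → y ∉ dom Γ → f ∉ dom Γ → ¬ (y ≡ f) →
        (Γ ▸ y ∶ A ▸ f ∶ Hom A (var x) (var y)) ⊢ps f ∶ Hom A (var x) (var y)
  psd : ∀ {Γ f A x y} → Γ ⊢ps f ∶ Hom A (var x) (var y) → Γ ⊢ps y ∶ A

data _⊢ps : CCtx → Set where
  ps : ∀ {Γ x} → Γ ⊢ps x ∶ ⋆ → Γ ⊢ps

infix 4 _⊢C _⊢Cty_ _⊢C_∶_ _⊢C_∶s_

mutual
  data _⊢C : CCtx → Set where
    ∅C  : ∅ ⊢C
    extC : ∀ {Γ x A} → Γ ⊢C → Γ ⊢Cty A → x ∉ dom Γ → (Γ ▸ x ∶ A) ⊢C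

  data _⊢Cty_ : CCtx → CTy → Set where
    ⋆C   : ∀ {Γ} → Γ ⊢C → Γ ⊢Cty ⋆
    homC : ∀ {Γ A t u} → Γ ⊢C t ∶ A → Γ ⊢C u ∶ A → Γ ⊢Cty Hom A t u

  data _⊢C_∶_ : CCtx → CTm → CTy → Set where
    varC : ∀ {Γ x A} → Γ ⊢C → lookupC Γ x ≡ just A → Γ ⊢C var x ∶ A
    opC  : ∀ {Δ Θ A γ} → IsOp Θ A → Δ ⊢C γ ∶s Θ → Δ ⊢C op Θ A γ ∶ A [ γ ]T
    cohC : ∀ {Δ Θ A γ} → IsCoh Θ A → Δ ⊢C γ ∶s Θ → Δ ⊢C coh Θ A γ ∶ A [ γ ]T

  data _⊢C_∶s_ : CCtx → CSub → CCtx → Set where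
    ⟨⟩C  : ∀ {Δ} → Δ ⊢C → Δ ⊢C ⟨⟩ ∶s ∅
    extC : ∀ {Δ γ Γ x A t} → Δ ⊢C γ ∶s Γ → (Γ ▸ x ∶ A) ⊢C →
           Δ ⊢C t ∶ A [ γ ]T → Δ ⊢C (γ ▹ x ↦ t) ∶s (Γ ▸ x ∶ A)

  data IsOp : CCtx → CTy → Set where
    isOp : ∀ {Θ A t u} → Θ ⊢ps →
           ∂⁻ Θ ⊢C t ∶ A → ∂⁺ Θ ⊢C u ∶ A →
           (VarTm t ++ VarTy A) ≈V dom (∂⁻ Θ) →
           (VarTm u ++ VarTy A) ≈V dom (∂⁺ Θ) →
           IsOp Θ (Hom A t u)

  data IsCoh : CCtx → CTy → Set where
    isCoh : ∀ {Θ A t u} → Θ ⊢ps → Θ ⊢Cty Hom A t u →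
            (VarTm t ++ VarTy A) ≈V dom Θ →
            (VarTm u ++ VarTy A) ≈V dom Θ →
            IsCoh Θ (Hom A t u)

infixl 5 _m▸_∶_ _m▹_↦_

mutual
  data MTy : Set where
    𝟙    : MTy
    MHom : MTy → MTm → MTm → MTy

  data MTm : Set where
    tt   : MTm
    mvar : ℕ → MTm
    mop  : CCtx → CTy → MSub → MTm
    mcoh : CCtx → CTy → MSub → MTm

  data MCtx : Set where
    m∅     : MCtx
    _m▸_∶_ : MCtx → ℕ → MTy → MCtx

  data MSub : Set where
    m⟨⟩    : MSub
    _m▹_↦_ : MSub → ℕ → MTm → MSub

-- ⋆ abbreviates Hom_𝟙 () ()
M⋆ : MTy
M⋆ = MHom 𝟙 tt tt

mdom : MCtx → List ℕ
mdom m∅ = []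
mdom (Γ m▸ x ∶ A) = x ∷ mdom Γ

lookupM : MCtx → ℕ → Maybe MTy
lookupM m∅ x = nothing
lookupM (Γ m▸ y ∶ A) x = if x ≡ᵇ y then just A else lookupM Γ x

lookupMS : MSub → ℕ → MTm
lookupMS m⟨⟩ x = mvar x
lookupMS (γ m▹ y ↦ t) x = if x ≡ᵇ y then t else lookupMS γ x

mutual
  _[_]MT : MTy → MSub → MTy
  𝟙 [ δ ]MT = 𝟙
  MHom A t u [ δ ]MT = MHom (A [ δ ]MT) (t [ δ ]Mt) (u [ δ ]Mt)

  _[_]Mt : MTm → MSub → MTm
  tt [ δ ]Mt = tt
  mvar x [ δ ]Mt = lookupMS δ x
  mop Θ A γ [ δ ]Mt = mop Θ A (γ ∘M δ)
  mcoh Θ A γ [ δ ]Mt = mcoh Θ A (γ ∘M δ)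

  _∘M_ : MSub → MSub → MSub
  m⟨⟩ ∘M δ = m⟨⟩
  (γ m▹ x ↦ t) ∘M δ = (γ ∘M δ) m▹ x ↦ (t [ δ ]Mt)

mutual
  DTy : CTy → MTy
  DTy ⋆ = 𝟙
  DTy (Hom A t u) = MHom (DTy A) (DTm t) (DTm u)

  DTm : CTm → MTm
  DTm (var x) = mvar x
  DTm (op Θ A γ) = mop Θ A (DSub γ)
  DTm (coh Θ A γ) = mcoh Θ A (DSub γ)

  DSub : CSub → MSub
  DSub ⟨⟩ = m⟨⟩
  DSub (γ ▹ x ↦ t) = DSub γ m▹ x ↦ DTm t

DCtx : CCtx → MCtx
DCtx ∅ = m∅
DCtx (Γ ▸ x ∶ A) = DCtx Γ m▸ x ∶ DTy A

infix 4 _⊢M _⊢Mty_ _⊢M_∶_ _⊢M_∶s_ _⊢M_≣ty_ _⊢M_≣_∶_ _⊢M_≣s_∶s_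

mutual
  data _⊢M : MCtx → Set where
    m∅M  : m∅ ⊢M
    extM : ∀ {Γ x A} → Γ ⊢M → Γ ⊢Mty A → x ∉ mdom Γ → (Γ m▸ x ∶ A) ⊢M

  data _⊢Mty_ : MCtx → MTy → Set where
    𝟙M   : ∀ {Γ} → Γ ⊢M → Γ ⊢Mty 𝟙
    homM : ∀ {Γ A t u} → Γ ⊢M t ∶ A → Γ ⊢M u ∶ A → Γ ⊢Mty MHom A t u

  data _⊢M_∶_ : MCtx → MTm → MTy → Set where
    ttM   : ∀ {Γ} → Γ ⊢M → Γ ⊢M tt ∶ 𝟙
    varM  : ∀ {Γ x A} → Γ ⊢M → lookupM Γ x ≡ just A → Γ ⊢M mvar x ∶ A
    mopM  : ∀ {Δ Θ A γ} → IsOp Θ A → Δ ⊢M γ ∶s DCtx Θ →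
            Δ ⊢M mop Θ A γ ∶ DTy A [ γ ]MT
    mcohM : ∀ {Δ Θ A γ} → IsCoh Θ A → Δ ⊢M γ ∶s DCtx Θ →
            Δ ⊢M mcoh Θ A γ ∶ DTy A [ γ ]MT
    convM : ∀ {Γ t A B} → Γ ⊢M t ∶ A → Γ ⊢M A ≣ty B → Γ ⊢M t ∶ B

  data _⊢M_∶s_ : MCtx → MSub → MCtx → Set where
    ⟨⟩M  : ∀ {Δ} → Δ ⊢M → Δ ⊢M m⟨⟩ ∶s m∅
    extM : ∀ {Δ γ Γ x A t} → Δ ⊢M γ ∶s Γ → (Γ m▸ x ∶ A) ⊢M →
           Δ ⊢M t ∶ A [ γ ]MT → Δ ⊢M (γ m▹ x ↦ t) ∶s (Γ m▸ x ∶ A)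

  data _⊢M_≣ty_ : MCtx → MTy → MTy → Set where
    reflTy  : ∀ {Γ A} → Γ ⊢Mty A → Γ ⊢M A ≣ty A
    symTy   : ∀ {Γ A B} → Γ ⊢M A ≣ty B → Γ ⊢M B ≣ty A
    transTy : ∀ {Γ A B C} → Γ ⊢M A ≣ty B → Γ ⊢M B ≣ty C → Γ ⊢M A ≣ty C
    homTy   : ∀ {Γ A A' t t' u u'} → Γ ⊢M A ≣ty A' →
              Γ ⊢M t ≣ t' ∶ A → Γ ⊢M u ≣ u' ∶ A →
              Γ ⊢M MHom A t u ≣ty MHom A' t' u'

  data _⊢M_≣_∶_ : MCtx → MTm → MTm → MTy → Set where
    reflTm  : ∀ {Γ t A} → Γ ⊢M t ∶ A → Γ ⊢M t ≣ t ∶ A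
    symTm   : ∀ {Γ t u A} → Γ ⊢M t ≣ u ∶ A → Γ ⊢M u ≣ t ∶ A
    transTm : ∀ {Γ t u v A} → Γ ⊢M t ≣ u ∶ A → Γ ⊢M u ≣ v ∶ A → Γ ⊢M t ≣ v ∶ A
    η𝟙      : ∀ {Γ t} → Γ ⊢M t ∶ 𝟙 → Γ ⊢M t ≣ tt ∶ 𝟙
    convTm  : ∀ {Γ t u A B} → Γ ⊢M t ≣ u ∶ A → Γ ⊢M A ≣ty B → Γ ⊢M t ≣ u ∶ B
    mopTm   : ∀ {Δ Θ A γ δ} → IsOp Θ A → Δ ⊢M γ ≣s δ ∶s DCtx Θ →
              Δ ⊢M mop Θ A γ ≣ mop Θ A δ ∶ DTy A [ γ ]MT
    mcohTm  : ∀ {Δ Θ A γ δ} → IsCoh Θ A → Δ ⊢M γ ≣s δ ∶s DCtx Θ →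
              Δ ⊢M mcoh Θ A γ ≣ mcoh Θ A δ ∶ DTy A [ γ ]MT

  data _⊢M_≣s_∶s_ : MCtx → MSub → MSub → MCtx → Set where
    ⟨⟩Eq  : ∀ {Δ} → Δ ⊢M → Δ ⊢M m⟨⟩ ≣s m⟨⟩ ∶s m∅
    extEq : ∀ {Δ γ δ Γ x A t u} → Δ ⊢M γ ≣s δ ∶s Γ → (Γ m▸ x ∶ A) ⊢M →
            Δ ⊢M t ≣ u ∶ A [ γ ]MT →
            Δ ⊢M (γ m▹ x ↦ t) ≣s (δ m▹ x ↦ u) ∶s (Γ m▸ x ∶ A)

-- Normal forms: no term of type 𝟙 other than ().  Syntactically: no
-- variable declared of type 𝟙 occurs (relative to the ambient context).

mutual
  data NFTy (Γ : MCtx) : MTy → Set where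
    nf𝟙   : NFTy Γ 𝟙
    nfHom : ∀ {A t u} → NFTy Γ A → NFTm Γ t → NFTm Γ u → NFTy Γ (MHom A t u)

  data NFTm (Γ : MCtx) : MTm → Set where
    nftt   : NFTm Γ tt
    nfvar  : ∀ {x} → ¬ (lookupM Γ x ≡ just 𝟙) → NFTm Γ (mvar x)
    nfmop  : ∀ {Θ A γ} → NFSub Γ γ → NFTm Γ (mop Θ A γ)
    nfmcoh : ∀ {Θ A γ} → NFSub Γ γ → NFTm Γ (mcoh Θ A γ)

  data NFSub (Γ : MCtx) : MSub → Set where
    nf⟨⟩ : NFSub Γ m⟨⟩
    nf▹  : ∀ {γ x t} → NFSub Γ γ → NFTm Γ t → NFSub Γ (γ m▹ x ↦ t)

data NFCtx : MCtx → Set where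
  nfm∅ : NFCtx m∅
  nfm▸ : ∀ {Γ x A} → NFCtx Γ → NFTy Γ A → NFCtx (Γ m▸ x ∶ A)

• : CTm
• = var 0

isUnit : Maybe MTy → Bool
isUnit (just 𝟙) = true
isUnit _ = false

-- •_Θ : x ↦ Σr(D x), i.e. • if x : ⋆ (D x has type 𝟙, normal form ()),
-- and the variable x (renamed suc x) otherwise
bulSub : CCtx → CSub
bulSub ∅ = ⟨⟩
bulSub (Θ ▸ x ∶ ⋆) = bulSub Θ ▹ x ↦ •
bulSub (Θ ▸ x ∶ Hom A t u) = bulSub Θ ▹ x ↦ var (suc x)

mutual
  ΣrTy : MTy → CTy
  ΣrTy 𝟙 = ⋆
  ΣrTy (MHom A t u) = Hom (ΣrTy A) (ΣrTm t) (ΣrTm u)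

  ΣrTm : MTm → CTm
  ΣrTm tt = •
  ΣrTm (mvar x) = var (suc x)
  ΣrTm (mop Θ A γ) = op Θ A (bulSub Θ ∘C ΣrSub (DCtx Θ) γ)
  ΣrTm (mcoh Θ A γ) = coh Θ A (bulSub Θ ∘C ΣrSub (DCtx Θ) γ)

  -- Σr of a substitution γ with target context Γ (needed to know whether
  -- a variable x has type 𝟙)
  ΣrSub : MCtx → MSub → CSub
  ΣrSub Γ m⟨⟩ = ⟨⟩ ▹ 0 ↦ •
  ΣrSub Γ (γ m▹ x ↦ t) =
    if isUnit (lookupM Γ x) then ΣrSub Γ γ
    else (ΣrSub Γ γ ▹ suc x ↦ ΣrTm t)

ΣrCtx : MCtx → CCtx
ΣrCtx m∅ = ∅ ▸ 0 ∶ ⋆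
ΣrCtx (Γ m▸ x ∶ 𝟙) = ΣrCtx Γ
ΣrCtx (Γ m▸ x ∶ MHom A t u) = ΣrCtx Γ ▸ suc x ∶ ΣrTy (MHom A t u)

module Submission where

-- Σr is first extended to all MCaTT expressions relative to the ambient
-- context Δ, sending the variables of type 𝟙 of Δ to •.  Every term of type 𝟙
-- then goes to •, so definitionally equal expressions have equal images and
-- the conversion rule costs nothing; on normal forms nothing changes.  The
-- extension commutes with substitution, and suspending D C [γ] gives
-- C [•_Θ ∘ Σr γ]: this is exactly what turns the MCaTT rules for mop and mcoh
-- into the CaTT rules for op and coh.

open import Defs
open import Data.Bool using (true; false; if_then_else_)
open import Data.Empty using (⊥-elim)
open import Data.List using (List; []; _∷_)
open import Data.List.Membership.Propositional using (_∈_; _∉_)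
open import Data.List.Relation.Unary.Any using (here; there)
open import Data.Maybe using (Maybe; just; nothing)
open import Data.Maybe.Properties using (just-injective)
open import Data.Nat using (ℕ; suc; _≡ᵇ_; _<ᵇ_; _≟_)
open import Data.Product using (Σ; _×_; _,_; proj₁; proj₂)
open import Relation.Binary.PropositionalEquality
open import Relation.Nullary using (Reflects; ofʸ; ofⁿ; proof)

≡ᵇ-reflects : ∀ m n → Reflects (m ≡ n) (m ≡ᵇ n)
≡ᵇ-reflects m n = proof (m ≟ n)

≡ᵇ-refl : ∀ n → (n ≡ᵇ n) ≡ true
≡ᵇ-refl n with n ≡ᵇ n | ≡ᵇ-reflects n n
... | true  | _        = refl
... | false | ofⁿ n≢n = ⊥-elim (n≢n refl)

≢⇒≡ᵇ-false : ∀ {m n} → m ≢ n → (m ≡ᵇ n) ≡ false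
≢⇒≡ᵇ-false {m} {n} m≢n with m ≡ᵇ n | ≡ᵇ-reflects m n
... | true  | ofʸ m≡n = ⊥-elim (m≢n m≡n)
... | false | _        = refl

∈-∉⇒≢ : ∀ {x y} {xs : List ℕ} → x ∈ xs → y ∉ xs → x ≢ y
∈-∉⇒≢ x∈ y∉ refl = y∉ x∈

lookupC-∈-dom : ∀ Γ x {A} → lookupC Γ x ≡ just A → x ∈ dom Γ
lookupC-∈-dom ∅ x ()
lookupC-∈-dom (Γ ▸ y ∶ B) x e with x ≡ᵇ y | ≡ᵇ-reflects x y
... | true  | ofʸ x≡y = here x≡y
... | false | _        = there (lookupC-∈-dom Γ x e)

lookupC-head : ∀ Γ x A → lookupC (Γ ▸ x ∶ A) x ≡ just A
lookupC-head Γ x A rewrite ≡ᵇ-refl x = refl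

lookupC-weaken : ∀ {Γ z B x A} → z ∉ dom Γ → lookupC Γ x ≡ just A →
                 lookupC (Γ ▸ z ∶ B) x ≡ just A
lookupC-weaken {Γ} {x = x} z∉ e
  rewrite ≢⇒≡ᵇ-false (∈-∉⇒≢ (lookupC-∈-dom Γ x e) z∉) = e

⊢C-fresh : ∀ {Γ z B} → (Γ ▸ z ∶ B) ⊢C → z ∉ dom Γ
⊢C-fresh (extC _ _ z∉) = z∉

module Weakening {Γ : CCtx} {z : ℕ} {B : CTy} (⊢Γz : (Γ ▸ z ∶ B) ⊢C) where
  mutual
    weaken-ty : ∀ {A} → Γ ⊢Cty A → (Γ ▸ z ∶ B) ⊢Cty A
    weaken-ty (⋆C _)     = ⋆C ⊢Γz
    weaken-ty (homC t u) = homC (weaken-tm t) (weaken-tm u)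

    weaken-tm : ∀ {t A} → Γ ⊢C t ∶ A → (Γ ▸ z ∶ B) ⊢C t ∶ A
    weaken-tm (varC _ e) = varC ⊢Γz (lookupC-weaken (⊢C-fresh ⊢Γz) e)
    weaken-tm (opC i σ)  = opC i (weaken-sub σ)
    weaken-tm (cohC i σ) = cohC i (weaken-sub σ)

    weaken-sub : ∀ {σ Θ} → Γ ⊢C σ ∶s Θ → (Γ ▸ z ∶ B) ⊢C σ ∶s Θ
    weaken-sub (⟨⟩C _)       = ⟨⟩C ⊢Γz
    weaken-sub (extC σ ⊢Θ t) = extC (weaken-sub σ) ⊢Θ (weaken-tm t)

open Weakening using (weaken-ty)

lookupC-wf : ∀ {Γ x A} → Γ ⊢C → lookupC Γ x ≡ just A → Γ ⊢Cty A
lookupC-wf ∅C ()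
lookupC-wf {x = x} ⊢Γz@(extC {x = z} ⊢Γ ⊢B _) e with x ≡ᵇ z
... | true  = subst (_ ⊢Cty_) (just-injective e) (weaken-ty ⊢Γz ⊢B)
... | false = weaken-ty ⊢Γz (lookupC-wf ⊢Γ e)

ps-wf : ∀ {Γ x A} → Γ ⊢ps x ∶ A → Γ ⊢C × lookupC Γ x ≡ just A
ps-wf (pss x) = extC ∅C (⋆C ∅C) (λ ()) , lookupC-head ∅ x ⋆
ps-wf (pse {Γ} {x} {A} {y} {f} Γ⊢x y∉ f∉ y≢f) with ps-wf Γ⊢x
... | ⊢Γ , lookup-x = ⊢Γyf , lookupC-head (Γ ▸ y ∶ A) f _
  where
  ⊢Γy : (Γ ▸ y ∶ A) ⊢C
  ⊢Γy = extC ⊢Γ (lookupC-wf ⊢Γ lookup-x) y∉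

  f∉Γy : f ∉ dom (Γ ▸ y ∶ A)
  f∉Γy (here f≡y) = y≢f (sym f≡y)
  f∉Γy (there f∈) = f∉ f∈

  ⊢Γyf : (Γ ▸ y ∶ A ▸ f ∶ Hom A (var x) (var y)) ⊢C
  ⊢Γyf = extC ⊢Γy
    (homC (varC ⊢Γy (lookupC-weaken y∉ lookup-x)) (varC ⊢Γy (lookupC-head Γ y A))) f∉Γy
ps-wf (psd Γ⊢f) with ps-wf Γ⊢f
... | ⊢Γ , lookup-f with lookupC-wf ⊢Γ lookup-f
...   | homC _ (varC _ lookup-y) = ⊢Γ , lookup-y

ps⇒⊢C : ∀ {Θ} → Θ ⊢ps → Θ ⊢C
ps⇒⊢C (ps Θ⊢x) = proj₁ (ps-wf Θ⊢x)

infix 4 _∋_∶_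

data _∋_∶_ : CCtx → ℕ → CTy → Set where
  here  : ∀ {Γ x A} → (Γ ▸ x ∶ A) ∋ x ∶ A
  there : ∀ {Γ x A y C} → Γ ∋ y ∶ C → (Γ ▸ x ∶ A) ∋ y ∶ C

lookupC⇒∋ : ∀ Γ y {C} → lookupC Γ y ≡ just C → Γ ∋ y ∶ C
lookupC⇒∋ ∅ y ()
lookupC⇒∋ (Γ ▸ x ∶ A) y e with y ≡ᵇ x | ≡ᵇ-reflects y x
lookupC⇒∋ (Γ ▸ x ∶ A) y refl | true  | ofʸ refl = here
...                          | false | _        = there (lookupC⇒∋ Γ y e)

∋⇒lookupC : ∀ {Θ y C} → Θ ⊢C → Θ ∋ y ∶ C → lookupC Θ y ≡ just C
∋⇒lookupC {Θ ▸ x ∶ A} _              here      = lookupC-head Θ x A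
∋⇒lookupC              (extC ⊢Θ _ x∉) (there e) = lookupC-weaken x∉ (∋⇒lookupC ⊢Θ e)

∋-drop : ∀ {Γ y C} → drop Γ ∋ y ∶ C → Γ ∋ y ∶ C
∋-drop {Γ ▸ x ∶ A} e = there e

∂⁻[]-∋ : ∀ i Θ {y C} → ∂⁻[ i ] Θ ∋ y ∶ C → Θ ∋ y ∶ C
∂⁻[]-∋ i ∅ ()
∂⁻[]-∋ i (∅ ▸ x ∶ A) e = e
∂⁻[]-∋ i (Γ ▸ y ∶ A ▸ f ∶ B) e with i <ᵇ suc (dimTy A)
... | true  = there (there (∂⁻[]-∋ i Γ e))
... | false = keep e
  where
  keep : ∀ {v C} → (∂⁻[ i ] Γ ▸ y ∶ A ▸ f ∶ B) ∋ v ∶ C → (Γ ▸ y ∶ A ▸ f ∶ B) ∋ v ∶ C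
  keep here               = here
  keep (there here)       = there here
  keep (there (there e′)) = there (there (∂⁻[]-∋ i Γ e′))

∂⁺[]-∋ : ∀ i Θ {y C} → ∂⁺[ i ] Θ ∋ y ∶ C → Θ ∋ y ∶ C
∂⁺[]-∋ i ∅ ()
∂⁺[]-∋ i (∅ ▸ x ∶ A) e = e
∂⁺[]-∋ i (Γ ▸ y ∶ A ▸ f ∶ B) e with i <ᵇ dimTy A
... | true = there (there (∂⁺[]-∋ i Γ e))
... | false with dimTy A ≡ᵇ i
...   | true = replace e
  where
  replace : ∀ {v C} → (drop (∂⁺[ i ] Γ) ▸ y ∶ A) ∋ v ∶ C → (Γ ▸ y ∶ A ▸ f ∶ B) ∋ v ∶ C
  replace here       = there here
  replace (there e′) = there (there (∂⁺[]-∋ i Γ (∋-drop e′)))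
...   | false = keep e
  where
  keep : ∀ {v C} → (∂⁺[ i ] Γ ▸ y ∶ A ▸ f ∶ B) ∋ v ∶ C → (Γ ▸ y ∶ A ▸ f ∶ B) ∋ v ∶ C
  keep here               = here
  keep (there here)       = there here
  keep (there (there e′)) = there (there (∂⁺[]-∋ i Γ e′))

infix 4 _⊆C_

_⊆C_ : CCtx → CCtx → Set
Γ ⊆C Θ = ∀ {y C} → lookupC Γ y ≡ just C → lookupC Θ y ≡ just C

∂⁻-⊆ : ∀ {Θ} → Θ ⊢C → ∂⁻ Θ ⊆C Θ
∂⁻-⊆ {Θ} ⊢Θ {y} e = ∋⇒lookupC ⊢Θ (∂⁻[]-∋ _ Θ (lookupC⇒∋ _ y e))

∂⁺-⊆ : ∀ {Θ} → Θ ⊢C → ∂⁺ Θ ⊆C Θ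
∂⁺-⊆ {Θ} ⊢Θ {y} e = ∋⇒lookupC ⊢Θ (∂⁺[]-∋ _ Θ (lookupC⇒∋ _ y e))

data Distinct : CCtx → Set where
  ∅   : Distinct ∅
  _▸_ : ∀ {Θ x A} → Distinct Θ → x ∉ dom Θ → Distinct (Θ ▸ x ∶ A)

⊢C⇒Distinct : ∀ {Θ} → Θ ⊢C → Distinct Θ
⊢C⇒Distinct ∅C             = ∅
⊢C⇒Distinct (extC ⊢Θ _ x∉) = ⊢C⇒Distinct ⊢Θ ▸ x∉

-- Scoping stands in for the presupposition "a typed term has a well-formed
-- type", which for op and coh would require a substitution lemma for typing.

data IsObjectVar (Γ : CCtx) : CTm → Set where
  var⋆ : ∀ {w} → lookupC Γ w ≡ just ⋆ → IsObjectVar Γ (var w)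

mutual
  data ScopedTy (Γ : CCtx) : CTy → Set where
    ⋆ˢ   : ScopedTy Γ ⋆
    Homˢ : ∀ {A t u} → ScopedTy Γ A → ScopedTm Γ t → ScopedTm Γ u → ScopedTy Γ (Hom A t u)

  data ScopedTm (Γ : CCtx) : CTm → Set where
    varˢ : ∀ {y C} → lookupC Γ y ≡ just C → ScopedTm Γ (var y)
    opˢ  : ∀ {σ Θ A} → ScopedSub Γ σ Θ → ScopedTm Γ (op Θ A σ)
    cohˢ : ∀ {σ Θ A} → ScopedSub Γ σ Θ → ScopedTm Γ (coh Θ A σ)

  -- Object variables must go to object variables, so that after •_Θ ∘ Σr γ
  -- they all become • (see ΣSub-D).
  data ScopedSub (Γ : CCtx) : CSub → CCtx → Set where
    ⟨⟩ˢ  : ScopedSub Γ ⟨⟩ ∅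
    extˢ : ∀ {σ Θ s C z} → ScopedSub Γ σ Θ → ScopedTm Γ s →
           (C ≡ ⋆ → IsObjectVar Γ s) → z ∉ dom Θ →
           ScopedSub Γ (σ ▹ z ↦ s) (Θ ▸ z ∶ C)

module ScopedMono {Γ Θ : CCtx} (Γ⊆Θ : Γ ⊆C Θ) where
  objectVar-mono : ∀ {s} → IsObjectVar Γ s → IsObjectVar Θ s
  objectVar-mono (var⋆ e) = var⋆ (Γ⊆Θ e)

  mutual
    scopedTy-mono : ∀ {A} → ScopedTy Γ A → ScopedTy Θ A
    scopedTy-mono ⋆ˢ           = ⋆ˢ
    scopedTy-mono (Homˢ A t u) = Homˢ (scopedTy-mono A) (scopedTm-mono t) (scopedTm-mono u)

    scopedTm-mono : ∀ {t} → ScopedTm Γ t → ScopedTm Θ t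
    scopedTm-mono (varˢ e) = varˢ (Γ⊆Θ e)
    scopedTm-mono (opˢ σ)  = opˢ (scopedSub-mono σ)
    scopedTm-mono (cohˢ σ) = cohˢ (scopedSub-mono σ)

    scopedSub-mono : ∀ {σ Θ′} → ScopedSub Γ σ Θ′ → ScopedSub Θ σ Θ′
    scopedSub-mono ⟨⟩ˢ = ⟨⟩ˢ
    scopedSub-mono (extˢ σ s obj z∉) =
      extˢ (scopedSub-mono σ) (scopedTm-mono s) (λ C≡⋆ → objectVar-mono (obj C≡⋆)) z∉

open ScopedMono

scopedSub-lookup : ∀ {Γ σ Θ y C} → ScopedSub Γ σ Θ → lookupC Θ y ≡ just C →
                   ScopedTm Γ (lookupS σ y) × (C ≡ ⋆ → IsObjectVar Γ (lookupS σ y))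
scopedSub-lookup ⟨⟩ˢ ()
scopedSub-lookup {y = y} (extˢ {z = z} σ s obj _) e with y ≡ᵇ z
scopedSub-lookup (extˢ σ s obj _) refl | true  = s , obj
...                                    | false = scopedSub-lookup σ e

objectVar-[] : ∀ {Γ σ Θ s} → ScopedSub Γ σ Θ → IsObjectVar Θ s → IsObjectVar Γ (s [ σ ]t)
objectVar-[] σ (var⋆ e) = proj₂ (scopedSub-lookup σ e) refl

mutual
  scopedTy-[] : ∀ {Γ σ Θ A} → ScopedTy Θ A → ScopedSub Γ σ Θ → ScopedTy Γ (A [ σ ]T)
  scopedTy-[] ⋆ˢ           σ = ⋆ˢ
  scopedTy-[] (Homˢ A t u) σ = Homˢ (scopedTy-[] A σ) (scopedTm-[] t σ) (scopedTm-[] u σ)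

  scopedTm-[] : ∀ {Γ σ Θ t} → ScopedTm Θ t → ScopedSub Γ σ Θ → ScopedTm Γ (t [ σ ]t)
  scopedTm-[] (varˢ e) σ = proj₁ (scopedSub-lookup σ e)
  scopedTm-[] (opˢ τ)  σ = opˢ (scopedSub-∘ τ σ)
  scopedTm-[] (cohˢ τ) σ = cohˢ (scopedSub-∘ τ σ)

  scopedSub-∘ : ∀ {Γ σ Θ τ Θ′} → ScopedSub Θ τ Θ′ → ScopedSub Γ σ Θ → ScopedSub Γ (τ ∘C σ) Θ′
  scopedSub-∘ ⟨⟩ˢ σ = ⟨⟩ˢ
  scopedSub-∘ (extˢ τ s obj z∉) σ =
    extˢ (scopedSub-∘ τ σ) (scopedTm-[] s σ) (λ C≡⋆ → objectVar-[] σ (obj C≡⋆)) z∉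

⊢⋆⇒objectVar : ∀ {Γ t B} → Γ ⊢C t ∶ B → B ≡ ⋆ → IsObjectVar Γ t
⊢⋆⇒objectVar (varC _ e) refl = var⋆ e
⊢⋆⇒objectVar (opC (isOp _ _ _ _ _) _) ()
⊢⋆⇒objectVar (cohC (isCoh _ _ _ _) _) ()

mutual
  ⊢Cty⇒scoped : ∀ {Γ A} → Γ ⊢Cty A → ScopedTy Γ A
  ⊢Cty⇒scoped (⋆C _)     = ⋆ˢ
  ⊢Cty⇒scoped (homC t u) = Homˢ (proj₂ (⊢C⇒scoped t)) (proj₁ (⊢C⇒scoped t)) (proj₁ (⊢C⇒scoped u))

  ⊢C⇒scoped : ∀ {Γ t A} → Γ ⊢C t ∶ A → ScopedTm Γ t × ScopedTy Γ A
  ⊢C⇒scoped (varC ⊢Γ e) = varˢ e , lookupC-scoped ⊢Γ e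
  ⊢C⇒scoped (opC i σ)   = opˢ (⊢Cs⇒scoped σ) , scopedTy-[] (isOp-scoped i) (⊢Cs⇒scoped σ)
  ⊢C⇒scoped (cohC i σ)  = cohˢ (⊢Cs⇒scoped σ) , scopedTy-[] (isCoh-scoped i) (⊢Cs⇒scoped σ)

  ⊢Cs⇒scoped : ∀ {Γ σ Θ} → Γ ⊢C σ ∶s Θ → ScopedSub Γ σ Θ
  ⊢Cs⇒scoped (⟨⟩C _) = ⟨⟩ˢ
  ⊢Cs⇒scoped (extC σ ⊢Θz t) =
    extˢ (⊢Cs⇒scoped σ) (proj₁ (⊢C⇒scoped t)) (λ { refl → ⊢⋆⇒objectVar t refl }) (⊢C-fresh ⊢Θz)

  lookupC-scoped : ∀ {Γ y A} → Γ ⊢C → lookupC Γ y ≡ just A → ScopedTy Γ A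
  lookupC-scoped ∅C ()
  lookupC-scoped {y = y} (extC {x = z} ⊢Γ ⊢B z∉) e with y ≡ᵇ z
  lookupC-scoped (extC ⊢Γ ⊢B z∉) refl | true  = scopedTy-mono (lookupC-weaken z∉) (⊢Cty⇒scoped ⊢B)
  ...                                 | false = scopedTy-mono (lookupC-weaken z∉) (lookupC-scoped ⊢Γ e)

  isOp-scoped : ∀ {Θ A} → IsOp Θ A → ScopedTy Θ A
  isOp-scoped (isOp Θ⊢ps t u _ _) =
    Homˢ (scopedTy-mono ∂⁻⊆Θ (proj₂ (⊢C⇒scoped t)))
         (scopedTm-mono ∂⁻⊆Θ (proj₁ (⊢C⇒scoped t)))
         (scopedTm-mono (∂⁺-⊆ (ps⇒⊢C Θ⊢ps)) (proj₁ (⊢C⇒scoped u)))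
    where ∂⁻⊆Θ = ∂⁻-⊆ (ps⇒⊢C Θ⊢ps)

  isCoh-scoped : ∀ {Θ A} → IsCoh Θ A → ScopedTy Θ A
  isCoh-scoped (isCoh _ ⊢A _ _) = ⊢Cty⇒scoped ⊢A

isOp-⊢C : ∀ {Θ A} → IsOp Θ A → Θ ⊢C
isOp-⊢C (isOp Θ⊢ps _ _ _ _) = ps⇒⊢C Θ⊢ps

isCoh-⊢C : ∀ {Θ A} → IsCoh Θ A → Θ ⊢C
isCoh-⊢C (isCoh Θ⊢ps _ _ _) = ps⇒⊢C Θ⊢ps

mnames : MSub → List ℕ
mnames m⟨⟩          = []
mnames (γ m▹ x ↦ t) = x ∷ mnames γ

mutual
  data MScopedTy (Γ : MCtx) : MTy → Set where
    𝟙ˢ    : MScopedTy Γ 𝟙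
    MHomˢ : ∀ {A t u} → MScopedTy Γ A → MScopedTm Γ t → MScopedTm Γ u →
            MScopedTy Γ (MHom A t u)

  data MScopedTm (Γ : MCtx) : MTm → Set where
    ttˢ   : MScopedTm Γ tt
    mvarˢ : ∀ {y A} → lookupM Γ y ≡ just A → MScopedTm Γ (mvar y)
    mopˢ  : ∀ {γ Θ A} → MScopedSub Γ γ → mnames γ ≡ dom Θ → Distinct Θ →
            MScopedTm Γ (mop Θ A γ)
    mcohˢ : ∀ {γ Θ A} → MScopedSub Γ γ → mnames γ ≡ dom Θ → Distinct Θ →
            MScopedTm Γ (mcoh Θ A γ)

  data MScopedSub (Γ : MCtx) : MSub → Set where
    m⟨⟩ˢ  : MScopedSub Γ m⟨⟩
    mextˢ : ∀ {γ x t} → MScopedSub Γ γ → MScopedTm Γ t → MScopedSub Γ (γ m▹ x ↦ t)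

infix 4 _⊆M_

_⊆M_ : MCtx → MCtx → Set
Γ ⊆M Γ′ = ∀ {y A} → lookupM Γ y ≡ just A → Σ MTy λ B → lookupM Γ′ y ≡ just B

⊆M-▸ : ∀ {Γ z B} → Γ ⊆M (Γ m▸ z ∶ B)
⊆M-▸ {Γ} {z} {B} {y} {A} e with y ≡ᵇ z
... | true  = B , refl
... | false = A , e

module MScopedMono {Γ Γ′ : MCtx} (Γ⊆Γ′ : Γ ⊆M Γ′) where
  mutual
    mscopedTy-mono : ∀ {A} → MScopedTy Γ A → MScopedTy Γ′ A
    mscopedTy-mono 𝟙ˢ            = 𝟙ˢ
    mscopedTy-mono (MHomˢ A t u) = MHomˢ (mscopedTy-mono A) (mscopedTm-mono t) (mscopedTm-mono u)

    mscopedTm-mono : ∀ {t} → MScopedTm Γ t → MScopedTm Γ′ t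
    mscopedTm-mono ttˢ               = ttˢ
    mscopedTm-mono (mvarˢ e)         = mvarˢ (proj₂ (Γ⊆Γ′ e))
    mscopedTm-mono (mopˢ γ names d)  = mopˢ (mscopedSub-mono γ) names d
    mscopedTm-mono (mcohˢ γ names d) = mcohˢ (mscopedSub-mono γ) names d

    mscopedSub-mono : ∀ {γ} → MScopedSub Γ γ → MScopedSub Γ′ γ
    mscopedSub-mono m⟨⟩ˢ        = m⟨⟩ˢ
    mscopedSub-mono (mextˢ γ t) = mextˢ (mscopedSub-mono γ) (mscopedTm-mono t)

open MScopedMono

mscopedSub-lookup : ∀ {Γ γ y} → MScopedSub Γ γ → y ∈ mnames γ → MScopedTm Γ (lookupMS γ y)
mscopedSub-lookup {y = y} (mextˢ {x = x} γ t) y∈ with y ≡ᵇ x | ≡ᵇ-reflects y x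
... | true  | _        = t
mscopedSub-lookup (mextˢ γ t) (here y≡x)  | false | ofⁿ y≢x = ⊥-elim (y≢x y≡x)
mscopedSub-lookup (mextˢ γ t) (there y∈) | false | _        = mscopedSub-lookup γ y∈

scopedSub-mnames : ∀ {Γ σ Θ} → ScopedSub Γ σ Θ → ∀ δ → mnames (DSub σ ∘M δ) ≡ dom Θ
scopedSub-mnames ⟨⟩ˢ                    δ = refl
scopedSub-mnames (extˢ {z = z} σ _ _ _) δ = cong (z ∷_) (scopedSub-mnames σ δ)

scopedSub-distinct : ∀ {Γ σ Θ} → ScopedSub Γ σ Θ → Distinct Θ
scopedSub-distinct ⟨⟩ˢ              = ∅
scopedSub-distinct (extˢ σ _ _ z∉) = scopedSub-distinct σ ▸ z∉

mutual
  D-scopedTy : ∀ {Θ C Γ δ} → ScopedTy Θ C → MScopedSub Γ δ → mnames δ ≡ dom Θ →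
               MScopedTy Γ (DTy C [ δ ]MT)
  D-scopedTy ⋆ˢ           δ names = 𝟙ˢ
  D-scopedTy (Homˢ A t u) δ names =
    MHomˢ (D-scopedTy A δ names) (D-scopedTm t δ names) (D-scopedTm u δ names)

  D-scopedTm : ∀ {Θ s Γ δ} → ScopedTm Θ s → MScopedSub Γ δ → mnames δ ≡ dom Θ →
               MScopedTm Γ (DTm s [ δ ]Mt)
  D-scopedTm {Θ} (varˢ {y} e) δ names =
    mscopedSub-lookup δ (subst (y ∈_) (sym names) (lookupC-∈-dom Θ y e))
  D-scopedTm {δ = δ′} (opˢ σ)  δ names =
    mopˢ (D-scopedSub σ δ names) (scopedSub-mnames σ δ′) (scopedSub-distinct σ)
  D-scopedTm {δ = δ′} (cohˢ σ) δ names =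
    mcohˢ (D-scopedSub σ δ names) (scopedSub-mnames σ δ′) (scopedSub-distinct σ)

  D-scopedSub : ∀ {Θ σ Θ′ Γ δ} → ScopedSub Θ σ Θ′ → MScopedSub Γ δ → mnames δ ≡ dom Θ →
                MScopedSub Γ (DSub σ ∘M δ)
  D-scopedSub ⟨⟩ˢ            δ names = m⟨⟩ˢ
  D-scopedSub (extˢ σ s _ _) δ names = mextˢ (D-scopedSub σ δ names) (D-scopedTm s δ names)

mdom-DCtx : ∀ Θ → mdom (DCtx Θ) ≡ dom Θ
mdom-DCtx ∅           = refl
mdom-DCtx (Θ ▸ x ∶ A) = cong (x ∷_) (mdom-DCtx Θ)

⊢Ms-mnames : ∀ {Δ γ Γ} → Δ ⊢M γ ∶s Γ → mnames γ ≡ mdom Γ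
⊢Ms-mnames (⟨⟩M _)              = refl
⊢Ms-mnames (extM {x = x} γ _ _) = cong (x ∷_) (⊢Ms-mnames γ)

≣s-mnames : ∀ {Δ γ δ Γ} → Δ ⊢M γ ≣s δ ∶s Γ → mnames γ ≡ mdom Γ × mnames δ ≡ mdom Γ
≣s-mnames (⟨⟩Eq _) = refl , refl
≣s-mnames (extEq {x = x} p _ _) =
  cong (x ∷_) (proj₁ (≣s-mnames p)) , cong (x ∷_) (proj₂ (≣s-mnames p))

mutual
  ⊢Mty⇒scoped : ∀ {Γ A} → Γ ⊢Mty A → MScopedTy Γ A
  ⊢Mty⇒scoped (𝟙M _)     = 𝟙ˢ
  ⊢Mty⇒scoped (homM t u) = MHomˢ (proj₂ (⊢M⇒scoped t)) (proj₁ (⊢M⇒scoped t)) (proj₁ (⊢M⇒scoped u))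

  ⊢M⇒scoped : ∀ {Γ t A} → Γ ⊢M t ∶ A → MScopedTm Γ t × MScopedTy Γ A
  ⊢M⇒scoped (ttM _)     = ttˢ , 𝟙ˢ
  ⊢M⇒scoped (varM ⊢Γ e) = mvarˢ e , lookupM-scoped ⊢Γ e
  ⊢M⇒scoped (mopM {Θ = Θ} i γ) =
    mopˢ (⊢Ms⇒scoped γ) names (⊢C⇒Distinct (isOp-⊢C i)) ,
    D-scopedTy (isOp-scoped i) (⊢Ms⇒scoped γ) names
    where names = trans (⊢Ms-mnames γ) (mdom-DCtx Θ)
  ⊢M⇒scoped (mcohM {Θ = Θ} i γ) =
    mcohˢ (⊢Ms⇒scoped γ) names (⊢C⇒Distinct (isCoh-⊢C i)) ,
    D-scopedTy (isCoh-scoped i) (⊢Ms⇒scoped γ) names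
    where names = trans (⊢Ms-mnames γ) (mdom-DCtx Θ)
  ⊢M⇒scoped (convM t A≣B) = proj₁ (⊢M⇒scoped t) , proj₂ (≣ty⇒scoped A≣B)

  ⊢Ms⇒scoped : ∀ {Γ γ Γ′} → Γ ⊢M γ ∶s Γ′ → MScopedSub Γ γ
  ⊢Ms⇒scoped (⟨⟩M _)      = m⟨⟩ˢ
  ⊢Ms⇒scoped (extM γ _ t) = mextˢ (⊢Ms⇒scoped γ) (proj₁ (⊢M⇒scoped t))

  ≣ty⇒scoped : ∀ {Γ A B} → Γ ⊢M A ≣ty B → MScopedTy Γ A × MScopedTy Γ B
  ≣ty⇒scoped (reflTy A)    = ⊢Mty⇒scoped A , ⊢Mty⇒scoped A
  ≣ty⇒scoped (symTy p)     = proj₂ (≣ty⇒scoped p) , proj₁ (≣ty⇒scoped p)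
  ≣ty⇒scoped (transTy p q) = proj₁ (≣ty⇒scoped p) , proj₂ (≣ty⇒scoped q)
  ≣ty⇒scoped (homTy A t u) =
    MHomˢ (proj₁ (≣ty⇒scoped A)) (proj₁ (≣⇒scoped t)) (proj₁ (≣⇒scoped u)) ,
    MHomˢ (proj₂ (≣ty⇒scoped A)) (proj₂ (≣⇒scoped t)) (proj₂ (≣⇒scoped u))

  ≣⇒scoped : ∀ {Γ t u A} → Γ ⊢M t ≣ u ∶ A → MScopedTm Γ t × MScopedTm Γ u
  ≣⇒scoped (reflTm t)    = proj₁ (⊢M⇒scoped t) , proj₁ (⊢M⇒scoped t)
  ≣⇒scoped (symTm p)     = proj₂ (≣⇒scoped p) , proj₁ (≣⇒scoped p)
  ≣⇒scoped (transTm p q) = proj₁ (≣⇒scoped p) , proj₂ (≣⇒scoped q)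
  ≣⇒scoped (η𝟙 t)        = proj₁ (⊢M⇒scoped t) , ttˢ
  ≣⇒scoped (convTm p _)  = ≣⇒scoped p
  ≣⇒scoped (mopTm {Θ = Θ} i p) =
    mopˢ (proj₁ (≣s⇒scoped p)) (trans (proj₁ (≣s-mnames p)) (mdom-DCtx Θ)) d ,
    mopˢ (proj₂ (≣s⇒scoped p)) (trans (proj₂ (≣s-mnames p)) (mdom-DCtx Θ)) d
    where d = ⊢C⇒Distinct (isOp-⊢C i)
  ≣⇒scoped (mcohTm {Θ = Θ} i p) =
    mcohˢ (proj₁ (≣s⇒scoped p)) (trans (proj₁ (≣s-mnames p)) (mdom-DCtx Θ)) d ,
    mcohˢ (proj₂ (≣s⇒scoped p)) (trans (proj₂ (≣s-mnames p)) (mdom-DCtx Θ)) d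
    where d = ⊢C⇒Distinct (isCoh-⊢C i)

  ≣s⇒scoped : ∀ {Γ γ δ Γ′} → Γ ⊢M γ ≣s δ ∶s Γ′ → MScopedSub Γ γ × MScopedSub Γ δ
  ≣s⇒scoped (⟨⟩Eq _)      = m⟨⟩ˢ , m⟨⟩ˢ
  ≣s⇒scoped (extEq p _ q) =
    mextˢ (proj₁ (≣s⇒scoped p)) (proj₁ (≣⇒scoped q)) , mextˢ (proj₂ (≣s⇒scoped p)) (proj₂ (≣⇒scoped q))

  lookupM-scoped : ∀ {Γ y A} → Γ ⊢M → lookupM Γ y ≡ just A → MScopedTy Γ A
  lookupM-scoped m∅M ()
  lookupM-scoped {y = y} (extM {Γ} {z} {B} ⊢Γ ⊢B _) e with y ≡ᵇ z
  ... | true  = mscopedTy-mono (⊆M-▸ {Γ} {z} {B}) (subst (MScopedTy _) (just-injective e) (⊢Mty⇒scoped ⊢B))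
  ... | false = mscopedTy-mono (⊆M-▸ {Γ} {z} {B}) (lookupM-scoped ⊢Γ e)

mutual
  ⊢Mty⇒⊢M : ∀ {Δ A} → Δ ⊢Mty A → Δ ⊢M
  ⊢Mty⇒⊢M (𝟙M ⊢Δ)    = ⊢Δ
  ⊢Mty⇒⊢M (homM t _) = ⊢M∶⇒⊢M t

  ⊢M∶⇒⊢M : ∀ {Δ t A} → Δ ⊢M t ∶ A → Δ ⊢M
  ⊢M∶⇒⊢M (ttM ⊢Δ)    = ⊢Δ
  ⊢M∶⇒⊢M (varM ⊢Δ _) = ⊢Δ
  ⊢M∶⇒⊢M (mopM _ γ)  = ⊢Ms⇒⊢M γ
  ⊢M∶⇒⊢M (mcohM _ γ) = ⊢Ms⇒⊢M γ
  ⊢M∶⇒⊢M (convM t _) = ⊢M∶⇒⊢M t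

  ⊢Ms⇒⊢M : ∀ {Δ γ Γ} → Δ ⊢M γ ∶s Γ → Δ ⊢M
  ⊢Ms⇒⊢M (⟨⟩M ⊢Δ)     = ⊢Δ
  ⊢Ms⇒⊢M (extM γ _ _) = ⊢Ms⇒⊢M γ

-- A variable declared of type 𝟙 in Δ goes to •, as its normal form () would.
mutual
  ΣTy : MCtx → MTy → CTy
  ΣTy Δ 𝟙            = ⋆
  ΣTy Δ (MHom A t u) = Hom (ΣTy Δ A) (ΣTm Δ t) (ΣTm Δ u)

  ΣTm : MCtx → MTm → CTm
  ΣTm Δ tt           = •
  ΣTm Δ (mvar x)     = if isUnit (lookupM Δ x) then • else var (suc x)
  ΣTm Δ (mop Θ A γ)  = op Θ A (bulSub Θ ∘C ΣSub Δ (DCtx Θ) γ)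
  ΣTm Δ (mcoh Θ A γ) = coh Θ A (bulSub Θ ∘C ΣSub Δ (DCtx Θ) γ)

  ΣSub : MCtx → MCtx → MSub → CSub
  ΣSub Δ Γ m⟨⟩          = ⟨⟩ ▹ 0 ↦ •
  ΣSub Δ Γ (γ m▹ x ↦ t) =
    if isUnit (lookupM Γ x) then ΣSub Δ Γ γ else (ΣSub Δ Γ γ ▹ suc x ↦ ΣTm Δ t)

cong-Hom : ∀ {A A′ t t′ u u′} → A ≡ A′ → t ≡ t′ → u ≡ u′ → Hom A t u ≡ Hom A′ t′ u′
cong-Hom refl refl refl = refl

isUnit-false : ∀ (m : Maybe MTy) → m ≢ just 𝟙 → isUnit m ≡ false
isUnit-false nothing             _   = refl
isUnit-false (just 𝟙)            m≢𝟙 = ⊥-elim (m≢𝟙 refl)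
isUnit-false (just (MHom _ _ _)) _   = refl

mutual
  ΣTy-NF : ∀ {Δ A} → NFTy Δ A → ΣTy Δ A ≡ ΣrTy A
  ΣTy-NF nf𝟙           = refl
  ΣTy-NF (nfHom A t u) = cong-Hom (ΣTy-NF A) (ΣTm-NF t) (ΣTm-NF u)

  ΣTm-NF : ∀ {Δ t} → NFTm Δ t → ΣTm Δ t ≡ ΣrTm t
  ΣTm-NF nftt = refl
  ΣTm-NF {Δ} (nfvar {x} x≢𝟙) rewrite isUnit-false (lookupM Δ x) x≢𝟙 = refl
  ΣTm-NF (nfmop {Θ} {A} γ)  = cong (λ σ → op Θ A (bulSub Θ ∘C σ)) (ΣSub-NF γ)
  ΣTm-NF (nfmcoh {Θ} {A} γ) = cong (λ σ → coh Θ A (bulSub Θ ∘C σ)) (ΣSub-NF γ)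

  ΣSub-NF : ∀ {Δ Γ γ} → NFSub Δ γ → ΣSub Δ Γ γ ≡ ΣrSub Γ γ
  ΣSub-NF nf⟨⟩ = refl
  ΣSub-NF {Γ = Γ} (nf▹ {x = x} γ t) with isUnit (lookupM Γ x)
  ... | true  = ΣSub-NF γ
  ... | false = cong₂ (λ σ s → σ ▹ suc x ↦ s) (ΣSub-NF γ) (ΣTm-NF t)

≣ty-𝟙 : ∀ {Δ A B} → Δ ⊢M A ≣ty B → (A ≡ 𝟙 → B ≡ 𝟙) × (B ≡ 𝟙 → A ≡ 𝟙)
≣ty-𝟙 (reflTy _)    = (λ e → e) , (λ e → e)
≣ty-𝟙 (symTy p)     = proj₂ (≣ty-𝟙 p) , proj₁ (≣ty-𝟙 p)
≣ty-𝟙 (transTy p q) = (λ e → proj₁ (≣ty-𝟙 q) (proj₁ (≣ty-𝟙 p) e)) ,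
                      (λ e → proj₂ (≣ty-𝟙 p) (proj₂ (≣ty-𝟙 q) e))
≣ty-𝟙 (homTy _ _ _) = (λ ()) , (λ ())

ΣTm-𝟙 : ∀ {Δ t A} → Δ ⊢M t ∶ A → A ≡ 𝟙 → ΣTm Δ t ≡ •
ΣTm-𝟙 (ttM _)                   _    = refl
ΣTm-𝟙 (varM _ e)                refl rewrite e = refl
ΣTm-𝟙 (mopM (isOp _ _ _ _ _) _) ()
ΣTm-𝟙 (mcohM (isCoh _ _ _ _) _) ()
ΣTm-𝟙 (convM t A≣B)             refl = ΣTm-𝟙 t (proj₂ (≣ty-𝟙 A≣B) refl)

mutual
  ΣTy-≣ : ∀ {Δ A B} → Δ ⊢M A ≣ty B → ΣTy Δ A ≡ ΣTy Δ B
  ΣTy-≣ (reflTy _)    = refl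
  ΣTy-≣ (symTy p)     = sym (ΣTy-≣ p)
  ΣTy-≣ (transTy p q) = trans (ΣTy-≣ p) (ΣTy-≣ q)
  ΣTy-≣ (homTy A t u) = cong-Hom (ΣTy-≣ A) (ΣTm-≣ t) (ΣTm-≣ u)

  ΣTm-≣ : ∀ {Δ t u A} → Δ ⊢M t ≣ u ∶ A → ΣTm Δ t ≡ ΣTm Δ u
  ΣTm-≣ (reflTm _)    = refl
  ΣTm-≣ (symTm p)     = sym (ΣTm-≣ p)
  ΣTm-≣ (transTm p q) = trans (ΣTm-≣ p) (ΣTm-≣ q)
  ΣTm-≣ (η𝟙 t)        = ΣTm-𝟙 t refl
  ΣTm-≣ (convTm p _)  = ΣTm-≣ p
  ΣTm-≣ (mopTm {Θ = Θ} {A} _ p)  = cong (λ σ → op Θ A (bulSub Θ ∘C σ)) (ΣSub-≣ p (DCtx Θ))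
  ΣTm-≣ (mcohTm {Θ = Θ} {A} _ p) = cong (λ σ → coh Θ A (bulSub Θ ∘C σ)) (ΣSub-≣ p (DCtx Θ))

  ΣSub-≣ : ∀ {Δ γ δ Γ} → Δ ⊢M γ ≣s δ ∶s Γ → ∀ Γ′ → ΣSub Δ Γ′ γ ≡ ΣSub Δ Γ′ δ
  ΣSub-≣ (⟨⟩Eq _) Γ′ = refl
  ΣSub-≣ (extEq {x = x} p _ q) Γ′ with isUnit (lookupM Γ′ x)
  ... | true  = ΣSub-≣ p Γ′
  ... | false = cong₂ (λ σ s → σ ▹ suc x ↦ s) (ΣSub-≣ p Γ′) (ΣTm-≣ q)

lookupM-∈-mdom : ∀ Γ x {A} → lookupM Γ x ≡ just A → x ∈ mdom Γ
lookupM-∈-mdom m∅ x ()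
lookupM-∈-mdom (Γ m▸ y ∶ B) x e with x ≡ᵇ y | ≡ᵇ-reflects x y
... | true  | ofʸ x≡y = here x≡y
... | false | _        = there (lookupM-∈-mdom Γ x e)

⊢Ms-lookup-∈ : ∀ {Δ γ Γ y A} → Δ ⊢M γ ∶s Γ → lookupM Γ y ≡ just A → y ∈ mnames γ
⊢Ms-lookup-∈ {Γ = Γ} {y} γ e = subst (y ∈_) (sym (⊢Ms-mnames γ)) (lookupM-∈-mdom Γ y e)

⊢Ms-lookup-𝟙 : ∀ {Δ γ Γ y} → Δ ⊢M γ ∶s Γ → lookupM Γ y ≡ just 𝟙 → Δ ⊢M lookupMS γ y ∶ 𝟙
⊢Ms-lookup-𝟙 (⟨⟩M _) ()
⊢Ms-lookup-𝟙 {y = y} (extM {x = x} γ _ t) e with y ≡ᵇ x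
⊢Ms-lookup-𝟙 (extM γ _ t) refl | true  = t
...                            | false = ⊢Ms-lookup-𝟙 γ e

ΣSub-lookup-0 : ∀ Δ Γ γ → lookupS (ΣSub Δ Γ γ) 0 ≡ •
ΣSub-lookup-0 Δ Γ m⟨⟩ = refl
ΣSub-lookup-0 Δ Γ (γ m▹ x ↦ t) with isUnit (lookupM Γ x)
... | true  = ΣSub-lookup-0 Δ Γ γ
... | false = ΣSub-lookup-0 Δ Γ γ

ΣSub-lookup-suc : ∀ Δ Γ γ y → y ∈ mnames γ → isUnit (lookupM Γ y) ≡ false →
                  lookupS (ΣSub Δ Γ γ) (suc y) ≡ ΣTm Δ (lookupMS γ y)
ΣSub-lookup-suc Δ Γ (γ m▹ x ↦ t) y y∈ y≠𝟙 with y ≡ᵇ x | ≡ᵇ-reflects y x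
... | true  | ofʸ refl rewrite y≠𝟙 | ≡ᵇ-refl y = refl
... | false | ofⁿ y≢x with y∈ | isUnit (lookupM Γ x)
...   | here y≡x  | _     = ⊥-elim (y≢x y≡x)
...   | there y∈γ | true  = ΣSub-lookup-suc Δ Γ γ y y∈γ y≠𝟙
...   | there y∈γ | false rewrite ≢⇒≡ᵇ-false y≢x = ΣSub-lookup-suc Δ Γ γ y y∈γ y≠𝟙

ΣSub-fresh : ∀ Δ Γ x A γ → x ∉ mnames γ → ΣSub Δ (Γ m▸ x ∶ A) γ ≡ ΣSub Δ Γ γ
ΣSub-fresh Δ Γ x A m⟨⟩ _ = refl
ΣSub-fresh Δ Γ x A (γ m▹ y ↦ t) x∉
  rewrite ≢⇒≡ᵇ-false {y} {x} (λ y≡x → x∉ (here (sym y≡x))) with isUnit (lookupM Γ y)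
... | true  = ΣSub-fresh Δ Γ x A γ (λ x∈ → x∉ (there x∈))
... | false = cong (_▹ suc y ↦ ΣTm Δ t) (ΣSub-fresh Δ Γ x A γ (λ x∈ → x∉ (there x∈)))

ΣSub-▹-𝟙 : ∀ Δ Γ z γ t → ΣSub Δ (Γ m▸ z ∶ 𝟙) (γ m▹ z ↦ t) ≡ ΣSub Δ (Γ m▸ z ∶ 𝟙) γ
ΣSub-▹-𝟙 Δ Γ z γ t rewrite ≡ᵇ-refl z = refl

ΣSub-▹-Hom : ∀ Δ Γ z A a b γ t →
             ΣSub Δ (Γ m▸ z ∶ MHom A a b) (γ m▹ z ↦ t) ≡
             (ΣSub Δ (Γ m▸ z ∶ MHom A a b) γ ▹ suc z ↦ ΣTm Δ t)
ΣSub-▹-Hom Δ Γ z A a b γ t rewrite ≡ᵇ-refl z = refl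

module ΣWeakening {Γ : MCtx} {z : ℕ} {B : MTy} (z∉ : z ∉ mdom Γ) where
  mutual
    ΣTy-weaken : ∀ {A} → MScopedTy Γ A → ΣTy (Γ m▸ z ∶ B) A ≡ ΣTy Γ A
    ΣTy-weaken 𝟙ˢ            = refl
    ΣTy-weaken (MHomˢ A t u) = cong-Hom (ΣTy-weaken A) (ΣTm-weaken t) (ΣTm-weaken u)

    ΣTm-weaken : ∀ {t} → MScopedTm Γ t → ΣTm (Γ m▸ z ∶ B) t ≡ ΣTm Γ t
    ΣTm-weaken ttˢ = refl
    ΣTm-weaken (mvarˢ {y} e)
      rewrite ≢⇒≡ᵇ-false (∈-∉⇒≢ (lookupM-∈-mdom Γ y e) z∉) = refl
    ΣTm-weaken (mopˢ {Θ = Θ} {A} γ _ _)  = cong (λ σ → op Θ A (bulSub Θ ∘C σ)) (ΣSub-weaken γ (DCtx Θ))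
    ΣTm-weaken (mcohˢ {Θ = Θ} {A} γ _ _) = cong (λ σ → coh Θ A (bulSub Θ ∘C σ)) (ΣSub-weaken γ (DCtx Θ))

    ΣSub-weaken : ∀ {γ} → MScopedSub Γ γ → ∀ Γ′ → ΣSub (Γ m▸ z ∶ B) Γ′ γ ≡ ΣSub Γ Γ′ γ
    ΣSub-weaken m⟨⟩ˢ Γ′ = refl
    ΣSub-weaken (mextˢ {x = x} γ t) Γ′ with isUnit (lookupM Γ′ x)
    ... | true  = ΣSub-weaken γ Γ′
    ... | false = cong₂ (λ σ s → σ ▹ suc x ↦ s) (ΣSub-weaken γ Γ′) (ΣTm-weaken t)

open ΣWeakening

cnames : CSub → List ℕ
cnames ⟨⟩          = []
cnames (σ ▹ x ↦ t) = x ∷ cnames σ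

-- lookupS σ w defaults to var w outside the domain of σ, hence the hypothesis.
lookupS-∘ : ∀ σ τ w → w ∈ cnames σ → lookupS (σ ∘C τ) w ≡ lookupS σ w [ τ ]t
lookupS-∘ (σ ▹ x ↦ t) τ w w∈ with w ≡ᵇ x | ≡ᵇ-reflects w x | w∈
... | true  | _        | _          = refl
... | false | ofⁿ w≢x | here w≡x  = ⊥-elim (w≢x w≡x)
... | false | _        | there w∈σ = lookupS-∘ σ τ w w∈σ

homVars : CCtx → List ℕ
homVars ∅                   = []
homVars (Θ ▸ x ∶ ⋆)         = homVars Θ
homVars (Θ ▸ x ∶ Hom _ _ _) = x ∷ homVars Θ

homVars-⊆-dom : ∀ Θ {y} → y ∈ homVars Θ → y ∈ dom Θ
homVars-⊆-dom (Θ ▸ x ∶ ⋆)         y∈          = there (homVars-⊆-dom Θ y∈)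
homVars-⊆-dom (Θ ▸ x ∶ Hom _ _ _) (here y≡x)  = here y≡x
homVars-⊆-dom (Θ ▸ x ∶ Hom _ _ _) (there y∈) = there (homVars-⊆-dom Θ y∈)

bulSub-∘-assoc : ∀ Θ τ σ → 0 ∈ cnames τ → (∀ y → y ∈ homVars Θ → suc y ∈ cnames τ) →
                 bulSub Θ ∘C (τ ∘C σ) ≡ (bulSub Θ ∘C τ) ∘C σ
bulSub-∘-assoc ∅ τ σ _ _ = refl
bulSub-∘-assoc (Θ ▸ x ∶ ⋆) τ σ 0∈ hom∈ =
  cong₂ (λ ρ s → ρ ▹ x ↦ s) (bulSub-∘-assoc Θ τ σ 0∈ hom∈) (lookupS-∘ τ σ 0 0∈)
bulSub-∘-assoc (Θ ▸ x ∶ Hom _ _ _) τ σ 0∈ hom∈ =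
  cong₂ (λ ρ s → ρ ▹ x ↦ s)
        (bulSub-∘-assoc Θ τ σ 0∈ (λ y y∈ → hom∈ y (there y∈)))
        (lookupS-∘ τ σ (suc x) (hom∈ x (here refl)))

ΣSub-0-∈ : ∀ Δ Γ γ → 0 ∈ cnames (ΣSub Δ Γ γ)
ΣSub-0-∈ Δ Γ m⟨⟩ = here refl
ΣSub-0-∈ Δ Γ (γ m▹ x ↦ t) with isUnit (lookupM Γ x)
... | true  = ΣSub-0-∈ Δ Γ γ
... | false = there (ΣSub-0-∈ Δ Γ γ)

ΣSub-suc-∈ : ∀ Δ Γ γ y → y ∈ mnames γ → isUnit (lookupM Γ y) ≡ false →
             suc y ∈ cnames (ΣSub Δ Γ γ)
ΣSub-suc-∈ Δ Γ (γ m▹ x ↦ t) y (here refl) y≠𝟙 rewrite y≠𝟙 = here refl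
ΣSub-suc-∈ Δ Γ (γ m▹ x ↦ t) y (there y∈) y≠𝟙 with isUnit (lookupM Γ x)
... | true  = ΣSub-suc-∈ Δ Γ γ y y∈ y≠𝟙
... | false = there (ΣSub-suc-∈ Δ Γ γ y y∈ y≠𝟙)

homVars-not-unit : ∀ Θ y → Distinct Θ → y ∈ homVars Θ → isUnit (lookupM (DCtx Θ) y) ≡ false
homVars-not-unit (Θ ▸ x ∶ ⋆) y (d ▸ x∉) y∈
  rewrite ≢⇒≡ᵇ-false (∈-∉⇒≢ (homVars-⊆-dom Θ y∈) x∉) = homVars-not-unit Θ y d y∈
homVars-not-unit (Θ ▸ x ∶ Hom _ _ _) y (d ▸ x∉) (here refl) rewrite ≡ᵇ-refl y = refl
homVars-not-unit (Θ ▸ x ∶ Hom _ _ _) y (d ▸ x∉) (there y∈)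
  rewrite ≢⇒≡ᵇ-false (∈-∉⇒≢ (homVars-⊆-dom Θ y∈) x∉) = homVars-not-unit Θ y d y∈

module ΣSubstitution {Δ : MCtx} {γ : MSub} {Γ : MCtx} (⊢γ : Δ ⊢M γ ∶s Γ) where
  σ : CSub
  σ = ΣSub Δ Γ γ

  mutual
    ΣTy-[] : ∀ {B} → MScopedTy Γ B → ΣTy Δ (B [ γ ]MT) ≡ ΣTy Γ B [ σ ]T
    ΣTy-[] 𝟙ˢ            = refl
    ΣTy-[] (MHomˢ B t u) = cong-Hom (ΣTy-[] B) (ΣTm-[] t) (ΣTm-[] u)

    ΣTm-[] : ∀ {t} → MScopedTm Γ t → ΣTm Δ (t [ γ ]Mt) ≡ ΣTm Γ t [ σ ]t
    ΣTm-[] ttˢ = sym (ΣSub-lookup-0 Δ Γ γ)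
    ΣTm-[] (mvarˢ {y} {𝟙} e) rewrite e =
      trans (ΣTm-𝟙 (⊢Ms-lookup-𝟙 ⊢γ e) refl) (sym (ΣSub-lookup-0 Δ Γ γ))
    ΣTm-[] (mvarˢ {y} {MHom _ _ _} e) rewrite e =
      sym (ΣSub-lookup-suc Δ Γ γ y (⊢Ms-lookup-∈ ⊢γ e) (cong isUnit e))
    ΣTm-[] (mopˢ {Θ = Θ} {A} δ names d)  = cong (op Θ A) (bulSub-ΣSub-∘ δ names d)
    ΣTm-[] (mcohˢ {Θ = Θ} {A} δ names d) = cong (coh Θ A) (bulSub-ΣSub-∘ δ names d)

    bulSub-ΣSub-∘ : ∀ {δ Θ} → MScopedSub Γ δ → mnames δ ≡ dom Θ → Distinct Θ →
                    bulSub Θ ∘C ΣSub Δ (DCtx Θ) (δ ∘M γ) ≡ (bulSub Θ ∘C ΣSub Γ (DCtx Θ) δ) ∘C σ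
    bulSub-ΣSub-∘ {δ} {Θ} δˢ names d =
      trans (cong (bulSub Θ ∘C_) (ΣSub-∘ δˢ (DCtx Θ)))
            (bulSub-∘-assoc Θ (ΣSub Γ (DCtx Θ) δ) σ (ΣSub-0-∈ Γ (DCtx Θ) δ) hom∈)
      where
      hom∈ : ∀ y → y ∈ homVars Θ → suc y ∈ cnames (ΣSub Γ (DCtx Θ) δ)
      hom∈ y y∈ = ΣSub-suc-∈ Γ (DCtx Θ) δ y (subst (y ∈_) (sym names) (homVars-⊆-dom Θ y∈))
                             (homVars-not-unit Θ y d y∈)

    ΣSub-∘ : ∀ {δ} → MScopedSub Γ δ → ∀ Γ′ → ΣSub Δ Γ′ (δ ∘M γ) ≡ ΣSub Γ Γ′ δ ∘C σ
    ΣSub-∘ m⟨⟩ˢ Γ′ = cong (⟨⟩ ▹ 0 ↦_) (sym (ΣSub-lookup-0 Δ Γ γ))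
    ΣSub-∘ (mextˢ {x = x} δ t) Γ′ with isUnit (lookupM Γ′ x)
    ... | true  = ΣSub-∘ δ Γ′
    ... | false = cong₂ (λ ρ s → ρ ▹ suc x ↦ s) (ΣSub-∘ δ Γ′) (ΣTm-[] t)

open ΣSubstitution using (ΣTy-[])

bulValue : CTy → ℕ → CTm
bulValue ⋆           y = •
bulValue (Hom _ _ _) y = var (suc y)

bulSub-∘-lookup : ∀ Θ τ y {C} → lookupC Θ y ≡ just C →
                  lookupS (bulSub Θ ∘C τ) y ≡ bulValue C y [ τ ]t
bulSub-∘-lookup ∅ τ y ()
bulSub-∘-lookup (Θ ▸ x ∶ ⋆) τ y e with y ≡ᵇ x
bulSub-∘-lookup (Θ ▸ x ∶ ⋆) τ y refl | true  = refl
...                                  | false = bulSub-∘-lookup Θ τ y e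
bulSub-∘-lookup (Θ ▸ x ∶ Hom _ _ _) τ y e with y ≡ᵇ x | ≡ᵇ-reflects y x
bulSub-∘-lookup (Θ ▸ x ∶ Hom _ _ _) τ y refl | true  | ofʸ refl = refl
...                                          | false | _        = bulSub-∘-lookup Θ τ y e

bulSub-∘-fresh : ∀ Θ σ x s → x ∉ dom Θ → bulSub Θ ∘C (σ ▹ suc x ↦ s) ≡ bulSub Θ ∘C σ
bulSub-∘-fresh ∅ σ x s x∉ = refl
bulSub-∘-fresh (Θ ▸ y ∶ ⋆) σ x s x∉ =
  cong (_▹ y ↦ lookupS σ 0) (bulSub-∘-fresh Θ σ x s (λ x∈ → x∉ (there x∈)))
bulSub-∘-fresh (Θ ▸ y ∶ Hom _ _ _) σ x s x∉
  rewrite ≢⇒≡ᵇ-false {y} {x} (λ y≡x → x∉ (here (sym y≡x))) =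
  cong (_▹ y ↦ lookupS σ (suc y)) (bulSub-∘-fresh Θ σ x s (λ x∈ → x∉ (there x∈)))

lookupM-DCtx : ∀ Θ y {C} → lookupC Θ y ≡ just C → lookupM (DCtx Θ) y ≡ just (DTy C)
lookupM-DCtx ∅ y ()
lookupM-DCtx (Θ ▸ x ∶ A) y e with y ≡ᵇ x
lookupM-DCtx (Θ ▸ x ∶ A) y refl | true  = refl
...                             | false = lookupM-DCtx Θ y e

-- The value of •_Θ ∘ Σr γ at a variable x : C of Θ, when Σr (γ x) = s.
ΣEntry : CTy → CTm → CTm
ΣEntry ⋆           s = •
ΣEntry (Hom _ _ _) s = s

bulSub-ΣSub-▹ : ∀ Δ Θ x C γ t → x ∉ dom Θ → x ∉ mnames γ →
                bulSub (Θ ▸ x ∶ C) ∘C ΣSub Δ (DCtx (Θ ▸ x ∶ C)) (γ m▹ x ↦ t) ≡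
                (bulSub Θ ∘C ΣSub Δ (DCtx Θ) γ) ▹ x ↦ ΣEntry C (ΣTm Δ t)
bulSub-ΣSub-▹ Δ Θ x ⋆ γ t x∉Θ x∉γ
  rewrite ΣSub-▹-𝟙 Δ (DCtx Θ) x γ t | ΣSub-fresh Δ (DCtx Θ) x 𝟙 γ x∉γ =
  cong ((bulSub Θ ∘C ΣSub Δ (DCtx Θ) γ) ▹ x ↦_) (ΣSub-lookup-0 Δ (DCtx Θ) γ)
bulSub-ΣSub-▹ Δ Θ x (Hom A a b) γ t x∉Θ x∉γ
  rewrite ΣSub-▹-Hom Δ (DCtx Θ) x (DTy A) (DTm a) (DTm b) γ t
        | ΣSub-fresh Δ (DCtx Θ) x (DTy (Hom A a b)) γ x∉γ
        | bulSub-∘-fresh Θ (ΣSub Δ (DCtx Θ) γ) x (ΣTm Δ t) x∉Θ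
        | ≡ᵇ-refl x = refl

module ΣDesuspension {Δ : MCtx} {Θ : CCtx} {γ : MSub} (⊢γ : Δ ⊢M γ ∶s DCtx Θ) where
  ρ : CSub
  ρ = bulSub Θ ∘C ΣSub Δ (DCtx Θ) γ

  objectVar-[ρ] : ∀ {s} → IsObjectVar Θ s → s [ ρ ]t ≡ •
  objectVar-[ρ] (var⋆ {w} e) =
    trans (bulSub-∘-lookup Θ (ΣSub Δ (DCtx Θ) γ) w e) (ΣSub-lookup-0 Δ (DCtx Θ) γ)

  mutual
    ΣTy-D : ∀ {C} → ScopedTy Θ C → ΣTy Δ (DTy C [ γ ]MT) ≡ C [ ρ ]T
    ΣTy-D ⋆ˢ           = refl
    ΣTy-D (Homˢ A t u) = cong-Hom (ΣTy-D A) (ΣTm-D t) (ΣTm-D u)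

    ΣTm-D : ∀ {s} → ScopedTm Θ s → ΣTm Δ (DTm s [ γ ]Mt) ≡ s [ ρ ]t
    ΣTm-D (varˢ {y} {⋆} e) =
      trans (ΣTm-𝟙 (⊢Ms-lookup-𝟙 ⊢γ (lookupM-DCtx Θ y e)) refl) (sym (objectVar-[ρ] (var⋆ e)))
    ΣTm-D (varˢ {y} {Hom A a b} e) =
      trans (sym (ΣSub-lookup-suc Δ (DCtx Θ) γ y (⊢Ms-lookup-∈ ⊢γ lookup-y) (cong isUnit lookup-y)))
            (sym (bulSub-∘-lookup Θ (ΣSub Δ (DCtx Θ) γ) y e))
      where lookup-y = lookupM-DCtx Θ y e
    ΣTm-D (opˢ {Θ = Θ′} {A} σ)  = cong (op Θ′ A) (ΣSub-D σ)
    ΣTm-D (cohˢ {Θ = Θ′} {A} σ) = cong (coh Θ′ A) (ΣSub-D σ)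

    ΣSub-D : ∀ {σ Θ′} → ScopedSub Θ σ Θ′ →
             bulSub Θ′ ∘C ΣSub Δ (DCtx Θ′) (DSub σ ∘M γ) ≡ σ ∘C ρ
    ΣSub-D ⟨⟩ˢ = refl
    ΣSub-D (extˢ {σ} {Θ′} {s} {C} {z} σˢ sˢ obj z∉) =
      trans (bulSub-ΣSub-▹ Δ Θ′ z C (DSub σ ∘M γ) (DTm s [ γ ]Mt) z∉ z∉names)
            (cong₂ (λ τ v → τ ▹ z ↦ v) (ΣSub-D σˢ) (entry C obj))
      where
      z∉names : z ∉ mnames (DSub σ ∘M γ)
      z∉names = subst (z ∉_) (sym (scopedSub-mnames σˢ γ)) z∉

      entry : ∀ C → (C ≡ ⋆ → IsObjectVar Θ s) → ΣEntry C (ΣTm Δ (DTm s [ γ ]Mt)) ≡ s [ ρ ]t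
      entry ⋆           obj = sym (objectVar-[ρ] (obj refl))
      entry (Hom _ _ _) _   = ΣTm-D sˢ

open ΣDesuspension using (ΣTy-D)

ΣrCtx-lookup-• : ∀ Δ → lookupC (ΣrCtx Δ) 0 ≡ just ⋆
ΣrCtx-lookup-• m∅                    = refl
ΣrCtx-lookup-• (Δ m▸ x ∶ 𝟙)          = ΣrCtx-lookup-• Δ
ΣrCtx-lookup-• (Δ m▸ x ∶ MHom _ _ _) = ΣrCtx-lookup-• Δ

ΣrCtx-lookup : ∀ {Δ x A a b} → Δ ⊢M → NFCtx Δ → lookupM Δ x ≡ just (MHom A a b) →
               lookupC (ΣrCtx Δ) (suc x) ≡ just (ΣTy Δ (MHom A a b))
ΣrCtx-lookup m∅M _ ()
ΣrCtx-lookup {x = x} (extM {x = z} _ _ _) _ _ with x ≡ᵇ z | ≡ᵇ-reflects x z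
ΣrCtx-lookup {x = x} (extM ⊢Γ ⊢B z∉) (nfm▸ nfΓ nfB) refl | true | ofʸ refl rewrite ≡ᵇ-refl x =
  cong just (sym (trans (ΣTy-weaken z∉ (⊢Mty⇒scoped ⊢B)) (ΣTy-NF nfB)))
ΣrCtx-lookup (extM {A = 𝟙} ⊢Γ _ z∉) (nfm▸ nfΓ _) e | false | _ =
  trans (ΣrCtx-lookup ⊢Γ nfΓ e) (cong just (sym (ΣTy-weaken z∉ (lookupM-scoped ⊢Γ e))))
ΣrCtx-lookup (extM {A = MHom _ _ _} ⊢Γ _ z∉) (nfm▸ nfΓ _) e | false | ofⁿ x≢z
  rewrite ≢⇒≡ᵇ-false x≢z =
  trans (ΣrCtx-lookup ⊢Γ nfΓ e) (cong just (sym (ΣTy-weaken z∉ (lookupM-scoped ⊢Γ e))))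

⊢Ms-fresh : ∀ {Δ γ Γ x A} → Δ ⊢M γ ∶s Γ → (Γ m▸ x ∶ A) ⊢M → x ∉ mnames γ
⊢Ms-fresh {x = x} γ (extM _ _ x∉) x∈ = x∉ (subst (x ∈_) (⊢Ms-mnames γ) x∈)

ΣrCtx-dom : ∀ Γ {x} → suc x ∈ dom (ΣrCtx Γ) → x ∈ mdom Γ
ΣrCtx-dom m∅ (here ())
ΣrCtx-dom m∅ (there ())
ΣrCtx-dom (Γ m▸ z ∶ 𝟙)          x∈          = there (ΣrCtx-dom Γ x∈)
ΣrCtx-dom (Γ m▸ z ∶ MHom _ _ _) (here refl) = here refl
ΣrCtx-dom (Γ m▸ z ∶ MHom _ _ _) (there x∈) = there (ΣrCtx-dom Γ x∈)

retype : ∀ {Γ t A B} → A ≡ B → Γ ⊢C t ∶ A → Γ ⊢C t ∶ B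
retype refl ⊢t = ⊢t

module Derivability {Δ : MCtx} (⊢Δ : Δ ⊢M) (nfΔ : NFCtx Δ) (⊢ΣΔ : ΣrCtx Δ ⊢C) where

  ⊢• : ΣrCtx Δ ⊢C • ∶ ⋆
  ⊢• = varC ⊢ΣΔ (ΣrCtx-lookup-• Δ)

  mutual
    Σ-⊢ty : ∀ {A} → Δ ⊢Mty A → ΣrCtx Δ ⊢Cty ΣTy Δ A
    Σ-⊢ty (𝟙M _)     = ⋆C ⊢ΣΔ
    Σ-⊢ty (homM t u) = homC (Σ-⊢tm t) (Σ-⊢tm u)

    Σ-⊢tm : ∀ {t A} → Δ ⊢M t ∶ A → ΣrCtx Δ ⊢C ΣTm Δ t ∶ ΣTy Δ A
    Σ-⊢tm (ttM _) = ⊢•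
    Σ-⊢tm (varM {A = 𝟙} _ e)          rewrite e = ⊢•
    Σ-⊢tm (varM {A = MHom _ _ _} _ e) rewrite e = varC ⊢ΣΔ (ΣrCtx-lookup ⊢Δ nfΔ e)
    Σ-⊢tm (mopM i γ)  = retype (sym (ΣTy-D γ (isOp-scoped i))) (opC i (Σ-⊢bul (isOp-⊢C i) γ))
    Σ-⊢tm (mcohM i γ) = retype (sym (ΣTy-D γ (isCoh-scoped i))) (cohC i (Σ-⊢bul (isCoh-⊢C i) γ))
    Σ-⊢tm (convM t A≣B) = retype (ΣTy-≣ A≣B) (Σ-⊢tm t)

    Σ-⊢bul : ∀ {Θ γ} → Θ ⊢C → Δ ⊢M γ ∶s DCtx Θ →
             ΣrCtx Δ ⊢C bulSub Θ ∘C ΣSub Δ (DCtx Θ) γ ∶s Θ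
    Σ-⊢bul ∅C (⟨⟩M _) = ⟨⟩C ⊢ΣΔ
    Σ-⊢bul ⊢Θx@(extC {Θ} {x} {B} ⊢Θ ⊢B x∉) (extM {γ = γ} {t = t} ⊢γ ⊢DΘx ⊢t) =
      subst (ΣrCtx Δ ⊢C_∶s (Θ ▸ x ∶ B))
            (sym (bulSub-ΣSub-▹ Δ Θ x B γ t x∉ (⊢Ms-fresh ⊢γ ⊢DΘx)))
            (extC (Σ-⊢bul ⊢Θ ⊢γ) ⊢Θx (entry B ⊢B ⊢t))
      where
      entry : ∀ B → Θ ⊢Cty B → Δ ⊢M t ∶ DTy B [ γ ]MT →
              ΣrCtx Δ ⊢C ΣEntry B (ΣTm Δ t) ∶ B [ bulSub Θ ∘C ΣSub Δ (DCtx Θ) γ ]T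
      entry ⋆           _  _  = ⊢•
      entry (Hom _ _ _) ⊢B ⊢t = retype (ΣTy-D ⊢γ (⊢Cty⇒scoped ⊢B)) (Σ-⊢tm ⊢t)

open Derivability

Σr-⊢ctx : ∀ {Δ} → NFCtx Δ → Δ ⊢M → ΣrCtx Δ ⊢C
Σr-⊢ctx nfm∅ m∅M = extC ∅C (⋆C ∅C) (λ ())
Σr-⊢ctx (nfm▸ nfΓ _) (extM {A = 𝟙} ⊢Γ _ _) = Σr-⊢ctx nfΓ ⊢Γ
Σr-⊢ctx (nfm▸ {Γ} nfΓ nfA) (extM {A = MHom _ _ _} ⊢Γ ⊢A x∉) =
  extC ⊢ΣΓ (subst (ΣrCtx Γ ⊢Cty_) (ΣTy-NF nfA) (Σ-⊢ty ⊢Γ nfΓ ⊢ΣΓ ⊢A)) (λ x∈ → x∉ (ΣrCtx-dom Γ x∈))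
  where ⊢ΣΓ = Σr-⊢ctx nfΓ ⊢Γ

Σ-⊢sub : ∀ {Δ γ Γ} → Δ ⊢M → NFCtx Δ → ΣrCtx Δ ⊢C → Δ ⊢M γ ∶s Γ → NFCtx Γ →
         ΣrCtx Δ ⊢C ΣSub Δ Γ γ ∶s ΣrCtx Γ
Σ-⊢sub ⊢Δ nfΔ ⊢ΣΔ (⟨⟩M _) nfm∅ =
  extC (⟨⟩C ⊢ΣΔ) (extC ∅C (⋆C ∅C) (λ ())) (⊢• ⊢Δ nfΔ ⊢ΣΔ)
Σ-⊢sub {Δ} ⊢Δ nfΔ ⊢ΣΔ (extM {γ = γ} {Γ} {x} {𝟙} {t} ⊢γ ⊢Γx _) (nfm▸ nfΓ _) =
  subst (ΣrCtx Δ ⊢C_∶s ΣrCtx Γ)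
        (sym (trans (ΣSub-▹-𝟙 Δ Γ x γ t) (ΣSub-fresh Δ Γ x 𝟙 γ (⊢Ms-fresh ⊢γ ⊢Γx))))
        (Σ-⊢sub ⊢Δ nfΔ ⊢ΣΔ ⊢γ nfΓ)
Σ-⊢sub {Δ} ⊢Δ nfΔ ⊢ΣΔ (extM {γ = γ} {Γ} {x} {MHom A a b} {t} ⊢γ ⊢Γx@(extM _ ⊢A _) ⊢t)
       nfΓx@(nfm▸ nfΓ nfA) =
  subst (ΣrCtx Δ ⊢C_∶s ΣrCtx (Γ m▸ x ∶ MHom A a b))
        (sym (trans (ΣSub-▹-Hom Δ Γ x A a b γ t)
                    (cong (_▹ suc x ↦ ΣTm Δ t) (ΣSub-fresh Δ Γ x (MHom A a b) γ (⊢Ms-fresh ⊢γ ⊢Γx)))))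
        (extC (Σ-⊢sub ⊢Δ nfΔ ⊢ΣΔ ⊢γ nfΓ) (Σr-⊢ctx nfΓx ⊢Γx)
              (retype (trans (ΣTy-[] ⊢γ (⊢Mty⇒scoped ⊢A)) (cong (_[ ΣSub Δ Γ γ ]T) (ΣTy-NF nfA)))
                      (Σ-⊢tm ⊢Δ nfΔ ⊢ΣΔ ⊢t)))

mainTheorem9 :
    (∀ {Δ} → NFCtx Δ → Δ ⊢M → ΣrCtx Δ ⊢C)
    × (∀ {Δ A} → NFCtx Δ → NFTy Δ A → Δ ⊢Mty A → ΣrCtx Δ ⊢Cty ΣrTy A)
    × (∀ {Δ t A} → NFCtx Δ → NFTm Δ t → NFTy Δ A → Δ ⊢M t ∶ A →
         ΣrCtx Δ ⊢C ΣrTm t ∶ ΣrTy A)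
    × (∀ {Δ γ Γ} → NFCtx Δ → NFSub Δ γ → NFCtx Γ → Δ ⊢M γ ∶s Γ →
         ΣrCtx Δ ⊢C ΣrSub Γ γ ∶s ΣrCtx Γ)
mainTheorem9 = Σr-⊢ctx , Σr-⊢ty , Σr-⊢tm , Σr-⊢sub
  where
  Σr-⊢ty : ∀ {Δ A} → NFCtx Δ → NFTy Δ A → Δ ⊢Mty A → ΣrCtx Δ ⊢Cty ΣrTy A
  Σr-⊢ty {Δ} nfΔ nfA ⊢A =
    subst (ΣrCtx Δ ⊢Cty_) (ΣTy-NF nfA) (Σ-⊢ty ⊢Δ nfΔ (Σr-⊢ctx nfΔ ⊢Δ) ⊢A)
    where ⊢Δ = ⊢Mty⇒⊢M ⊢A

  Σr-⊢tm : ∀ {Δ t A} → NFCtx Δ → NFTm Δ t → NFTy Δ A → Δ ⊢M t ∶ A → ΣrCtx Δ ⊢C ΣrTm t ∶ ΣrTy A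
  Σr-⊢tm {Δ} nfΔ nft nfA ⊢t =
    subst₂ (ΣrCtx Δ ⊢C_∶_) (ΣTm-NF nft) (ΣTy-NF nfA) (Σ-⊢tm ⊢Δ nfΔ (Σr-⊢ctx nfΔ ⊢Δ) ⊢t)
    where ⊢Δ = ⊢M∶⇒⊢M ⊢t

  Σr-⊢sub : ∀ {Δ γ Γ} → NFCtx Δ → NFSub Δ γ → NFCtx Γ → Δ ⊢M γ ∶s Γ →
            ΣrCtx Δ ⊢C ΣrSub Γ γ ∶s ΣrCtx Γ
  Σr-⊢sub {Δ} {Γ = Γ} nfΔ nfγ nfΓ ⊢γ =
    subst (ΣrCtx Δ ⊢C_∶s ΣrCtx Γ) (ΣSub-NF nfγ) (Σ-⊢sub ⊢Δ nfΔ (Σr-⊢ctx nfΔ ⊢Δ) ⊢γ nfΓ)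
    where ⊢Δ = ⊢Ms⇒⊢M ⊢γ
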